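{- Let $Q$ be a complete quiver and let $j$ be a mutable vertex which is cycle-preserving for $Q$ and is red or green. Then every red or green vertex of $Q$ is red or green in $\mu_j(Q)$. Moreover, for each mutable vertex $k$ which is neither red nor green in $Q$, either the weights $b_{ku}$ for all frozen vertices $u$ are the same in $Q$ and $\mu_j(Q)$, or $k$ is red or green in $\mu_j(Q)$.
   Context: Quiver: finite directed graph without loops or oriented 2-cycles, vertices partitioned into mutable and frozen, arrows between frozen vertices ignored; $b_{ij}$ = #arrows $i\to j$ − #arrows $j\to i$. Mutation $\mu_j$: for each path $i\xrightarrow{a}j\xrightarrow{b}k$ add $ab$ arrows $i\to k$, reverse arrows at $j$, cancel 2-cycles. Complete: at least one arrow between each pair of vertices at least one mutable. A 3-vertex quiver is an oriented cycle if it has at most one frozen vertex and is not acyclic. $j$ is cycle-preserving for $Q$ if whenever $Q|_{ijk}$ is an oriented 3-cycle containing $j$, so is $\mu_j(Q)|_{ijk}$. A mutable vertex adjacent to a frozen vertex is red (green) if all arrows between it and frozen vertices point toward (away from) it. -}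

module Defs where

open import Data.Nat using (ℕ)
open import Data.Bool using (Bool; true; false; if_then_else_)
open import Data.Fin using (Fin; _≟_)
open import Data.Integer using (ℤ; 0ℤ; _+_; _-_; _*_; -_; _⊔_; _≤_; _<_)
open import Data.Product using (_×_; ∃)
open import Data.Sum using (_⊎_)
open import Relation.Nullary using (¬_; does)
open import Relation.Binary.PropositionalEquality using (_≡_; _≢_)

-- A quiver on vertex set Fin n: frozen/mutable partition and the
-- exchange matrix b i k = #arrows i→k − #arrows k→i.
-- (No loops / no 2-cycles are built in by recording only the signed count;
--  entries between two frozen vertices are irrelevant everywhere below.)
record Quiver (n : ℕ) : Set where
  field
    frozen : Fin n → Bool
    b      : Fin n → Fin n → ℤ
open Quiver public

Mutable : ∀ {n} → Quiver n → Fin n → Set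
Mutable Q v = frozen Q v ≡ false

Frozen : ∀ {n} → Quiver n → Fin n → Set
Frozen Q v = frozen Q v ≡ true

SkewSymmetric : ∀ {n} → Quiver n → Set
SkewSymmetric Q = ∀ i k → b Q k i ≡ - b Q i k

[_]₊ : ℤ → ℤ
[ x ]₊ = x ⊔ 0ℤ

-- Mutation at j: reverse arrows at j; for each path i → j → k add
-- b_ij b_jk arrows i → k (and symmetrically k → j → i gives arrows k → i),
-- then cancel 2-cycles (i.e. take the signed count).
μ : ∀ {n} → Fin n → Quiver n → Quiver n
μ j Q = record
  { frozen = frozen Q
  ; b = λ i k → if does (i ≟ j) then - b Q i k
                else if does (k ≟ j) then - b Q i k
                else b Q i k + [ b Q i j ]₊ * [ b Q j k ]₊
                             - [ b Q k j ]₊ * [ b Q j i ]₊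
  }

Complete : ∀ {n} → Quiver n → Set
Complete Q = ∀ i k → i ≢ k → (Mutable Q i ⊎ Mutable Q k) → b Q i k ≢ 0ℤ

-- Q restricted to {i,j,k} (distinct) is an oriented cycle: at most one of
-- the three is frozen and the full subquiver is not acyclic; on three
-- vertices without loops/2-cycles this means i→j→k→i or i←j←k←i.
AtMostOneFrozen : ∀ {n} → Quiver n → Fin n → Fin n → Fin n → Set
AtMostOneFrozen Q i j k =
  (Mutable Q i × Mutable Q j) ⊎ (Mutable Q j × Mutable Q k) ⊎ (Mutable Q i × Mutable Q k)

HasOrientedCycle : ∀ {n} → Quiver n → Fin n → Fin n → Fin n → Set
HasOrientedCycle Q i j k =
  (0ℤ < b Q i j × 0ℤ < b Q j k × 0ℤ < b Q k i) ⊎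
  (b Q i j < 0ℤ × b Q j k < 0ℤ × b Q k i < 0ℤ)

IsOrientedCycle : ∀ {n} → Quiver n → Fin n → Fin n → Fin n → Set
IsOrientedCycle Q i j k =
  i ≢ j × j ≢ k × i ≢ k × AtMostOneFrozen Q i j k × HasOrientedCycle Q i j k

CyclePreserving : ∀ {n} → Quiver n → Fin n → Set
CyclePreserving Q j =
  ∀ i k → IsOrientedCycle Q i j k → IsOrientedCycle (μ j Q) i j k

AdjacentToFrozen : ∀ {n} → Quiver n → Fin n → Set
AdjacentToFrozen Q v = ∃ λ u → Frozen Q u × b Q v u ≢ 0ℤ

Red : ∀ {n} → Quiver n → Fin n → Set
Red Q v = Mutable Q v × AdjacentToFrozen Q v × (∀ u → Frozen Q u → b Q v u ≤ 0ℤ)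

Green : ∀ {n} → Quiver n → Fin n → Set
Green Q v = Mutable Q v × AdjacentToFrozen Q v × (∀ u → Frozen Q u → 0ℤ ≤ b Q v u)

RedOrGreen : ∀ {n} → Quiver n → Fin n → Set
RedOrGreen Q v = Red Q v ⊎ Green Q v

{-# OPTIONS --safe #-}
module Submission where

open import Defs
open import Data.Bool using (true; false)
open import Data.Nat using (ℕ; z≤n; s≤s)
open import Data.Fin using (Fin; _≟_)
open import Data.Integer using (ℤ; 0ℤ; _+_; _-_; _*_; -_; _≤_; _<_; +<+)
open import Data.Integer.Properties
  using (_≤?_; <-cmp; ≰⇒>; ≤∧≢⇒<; <⇒≤; <⇒≢; <-asym; i≤j⇒i⊔j≡j; i≥j⇒i⊔j≡i;
         neg-mono-<; neg-mono-≤; neg-injective; +-mono-<; +-identityʳ; *-zeroʳ)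
open import Data.Product using (_×_; _,_; proj₁; proj₂)
open import Data.Sum using (_⊎_; inj₁; inj₂; [_,_]′; map; map₂; swap)
open import Function using (_∘_; id)
open import Relation.Binary using (tri<; tri≈; tri>)
open import Relation.Binary.PropositionalEquality
  using (_≡_; _≢_; refl; sym; trans; cong; cong₂; subst; ≢-sym; module ≡-Reasoning)
open import Relation.Nullary using (¬_; Dec; yes; no; does; contradiction)
open import Relation.Nullary.Decidable using (dec-true; dec-false)

-- Completeness makes every red (green) vertex have strictly negative
-- (positive) weights towards all frozen vertices.  Say j is green, so
-- j → u for every frozen u.  If a mutable v ≠ j has no arrow v → j, there
-- is no path v → j → u or u → j → v through a frozen u, so the frozen
-- weights of v are unchanged.  If v → j, every frozen weight of v becomes
-- positive: for v → u the paths v → j → u only add arrows v → u, and for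
-- u → v the triangle v → j → u → v is an oriented cycle, which μ_j keeps
-- oriented while reversing j → u, so it must reverse u → v as well.  The
-- red case is dual, and j itself swaps colour because μ_j negates its row.

pos*pos⇒pos : ∀ {x y} → 0ℤ < x → 0ℤ < y → 0ℤ < x * y
pos*pos⇒pos (+<+ (s≤s z≤n)) (+<+ (s≤s z≤n)) = +<+ (s≤s z≤n)

[]₊-pos : ∀ {x} → 0ℤ < x → [ x ]₊ ≡ x
[]₊-pos = i≥j⇒i⊔j≡i ∘ <⇒≤

module _ {n : ℕ} (Q : Quiver n) where

  FrozenPositive FrozenNegative : Fin n → Set
  FrozenPositive v = ∀ u → Frozen Q u → 0ℤ < b Q v u
  FrozenNegative v = ∀ u → Frozen Q u → b Q v u < 0ℤ

  mutable≢frozen : ∀ {v u} → Mutable Q v → Frozen Q u → v ≢ u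
  mutable≢frozen mv fu refl = contradiction (trans (sym mv) fu) λ ()

  redOrGreen⇒mutable : ∀ {v} → RedOrGreen Q v → Mutable Q v
  redOrGreen⇒mutable (inj₁ (mv , _)) = mv
  redOrGreen⇒mutable (inj₂ (mv , _)) = mv

  complete⇒mutable-frozen-b≢0 : Complete Q → ∀ {v u} → Mutable Q v → Frozen Q u → b Q v u ≢ 0ℤ
  complete⇒mutable-frozen-b≢0 complete {v} {u} mv fu = complete v u (mutable≢frozen mv fu) (inj₁ mv)

  green⇒frozenPositive : Complete Q → ∀ {v} → Green Q v → FrozenPositive v
  green⇒frozenPositive complete (mv , _ , nonneg) u fu =
    ≤∧≢⇒< (nonneg u fu) (≢-sym (complete⇒mutable-frozen-b≢0 complete mv fu))

  red⇒frozenNegative : Complete Q → ∀ {v} → Red Q v → FrozenNegative v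
  red⇒frozenNegative complete (mv , _ , nonpos) u fu =
    ≤∧≢⇒< (nonpos u fu) (complete⇒mutable-frozen-b≢0 complete mv fu)

  frozenPositive⇒green : ∀ {v u} → Mutable Q v → Frozen Q u → FrozenPositive v → Green Q v
  frozenPositive⇒green {u = u} mv fu pos =
    mv , (u , fu , ≢-sym (<⇒≢ (pos u fu))) , λ u′ fu′ → <⇒≤ (pos u′ fu′)

  frozenNegative⇒red : ∀ {v u} → Mutable Q v → Frozen Q u → FrozenNegative v → Red Q v
  frozenNegative⇒red {u = u} mv fu neg =
    mv , (u , fu , <⇒≢ (neg u fu)) , λ u′ fu′ → <⇒≤ (neg u′ fu′)

  skew-pos : SkewSymmetric Q → ∀ {i k} → 0ℤ < b Q i k → b Q k i < 0ℤ
  skew-pos skew {i} {k} ik>0 = subst (_< 0ℤ) (sym (skew i k)) (neg-mono-< ik>0)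

  skew-neg : SkewSymmetric Q → ∀ {i k} → b Q i k < 0ℤ → 0ℤ < b Q k i
  skew-neg skew {i} {k} ik<0 = subst (0ℤ <_) (sym (skew i k)) (neg-mono-< ik<0)

module _ {n : ℕ} (Q : Quiver n) (j : Fin n) where
  open ≡-Reasoning

  FrozenWeightsFixed : Fin n → Set
  FrozenWeightsFixed v = ∀ u → Frozen Q u → b (μ j Q) v u ≡ b Q v u

  b-μ-row : ∀ u → b (μ j Q) j u ≡ - b Q j u
  b-μ-row u rewrite dec-true (j ≟ j) refl = refl

  b-μ-column : ∀ v → b (μ j Q) v j ≡ - b Q v j
  b-μ-column v with does (v ≟ j)
  ... | true  = refl
  ... | false rewrite dec-true (j ≟ j) refl = refl

  b-μ-≢ : ∀ {v u} → v ≢ j → u ≢ j →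
    b (μ j Q) v u ≡ b Q v u + [ b Q v j ]₊ * [ b Q j u ]₊ - [ b Q u j ]₊ * [ b Q j v ]₊
  b-μ-≢ {v} {u} v≢j u≢j rewrite dec-false (v ≟ j) v≢j | dec-false (u ≟ j) u≢j = refl

  b-μ-≢-when-u↛j : ∀ {v u} → v ≢ j → u ≢ j → b Q u j ≤ 0ℤ →
    b (μ j Q) v u ≡ b Q v u + [ b Q v j ]₊ * [ b Q j u ]₊
  b-μ-≢-when-u↛j {v} {u} v≢j u≢j uj≤0 = begin
    b (μ j Q) v u                          ≡⟨ b-μ-≢ v≢j u≢j ⟩
    b Q v u + P - [ b Q u j ]₊ * [ b Q j v ]₊
      ≡⟨ cong (λ x → b Q v u + P - x * [ b Q j v ]₊) (i≤j⇒i⊔j≡j uj≤0) ⟩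
    b Q v u + P + 0ℤ                       ≡⟨ +-identityʳ (b Q v u + P) ⟩
    b Q v u + P                            ∎
    where
    P : ℤ
    P = [ b Q v j ]₊ * [ b Q j u ]₊

  b-μ-≢-when-j↛u : ∀ {v u} → v ≢ j → u ≢ j → b Q j u ≤ 0ℤ →
    b (μ j Q) v u ≡ b Q v u - [ b Q u j ]₊ * [ b Q j v ]₊
  b-μ-≢-when-j↛u {v} {u} v≢j u≢j ju≤0 = begin
    b (μ j Q) v u                          ≡⟨ b-μ-≢ v≢j u≢j ⟩
    b Q v u + [ b Q v j ]₊ * [ b Q j u ]₊ - N
      ≡⟨ cong (λ x → b Q v u + [ b Q v j ]₊ * x - N) (i≤j⇒i⊔j≡j ju≤0) ⟩
    b Q v u + [ b Q v j ]₊ * 0ℤ - N        ≡⟨ cong (λ x → b Q v u + x - N) (*-zeroʳ [ b Q v j ]₊) ⟩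
    b Q v u + 0ℤ - N                       ≡⟨ cong (_- N) (+-identityʳ (b Q v u)) ⟩
    b Q v u - N                            ∎
    where
    N : ℤ
    N = [ b Q u j ]₊ * [ b Q j v ]₊

  b-μ-column-reverses⁺ : ∀ {v} → 0ℤ < b Q v j → b (μ j Q) v j < 0ℤ
  b-μ-column-reverses⁺ {v} vj>0 = subst (_< 0ℤ) (sym (b-μ-column v)) (neg-mono-< vj>0)

  b-μ-column-reverses⁻ : ∀ {v} → b Q v j < 0ℤ → 0ℤ < b (μ j Q) v j
  b-μ-column-reverses⁻ {v} vj<0 = subst (0ℤ <_) (sym (b-μ-column v)) (neg-mono-< vj<0)

  cyclePreserving⇒opposite-arrow-reversed :
    CyclePreserving Q j → ∀ {i k} → IsOrientedCycle Q i j k →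
    (0ℤ < b Q k i → b (μ j Q) k i < 0ℤ) × (b Q k i < 0ℤ → 0ℤ < b (μ j Q) k i)
  cyclePreserving⇒opposite-arrow-reversed cp {i} {k} cyc@(_ , _ , _ , _ , orientation)
    with orientation | cp i k cyc
  ... | inj₁ (_ , _ , ki>0) | _ , _ , _ , _ , inj₂ (_ , _ , ki′<0) =
        (λ _ → ki′<0) , λ ki<0 → contradiction ki>0 (<-asym ki<0)
  ... | inj₂ (_ , _ , ki<0) | _ , _ , _ , _ , inj₁ (_ , _ , ki′>0) =
        (λ ki>0 → contradiction ki>0 (<-asym ki<0)) , λ _ → ki′>0
  ... | inj₁ (ij>0 , _) | _ , _ , _ , _ , inj₁ (ij′>0 , _) =
        contradiction ij′>0 (<-asym (b-μ-column-reverses⁺ ij>0))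
  ... | inj₂ (ij<0 , _) | _ , _ , _ , _ , inj₂ (ij′<0 , _) =
        contradiction ij′<0 (<-asym (b-μ-column-reverses⁻ ij<0))

  adjacentToFrozen-fixed : ∀ {v} → FrozenWeightsFixed v →
    AdjacentToFrozen Q v → AdjacentToFrozen (μ j Q) v
  adjacentToFrozen-fixed fixed (u , fu , vu≢0) = u , fu , vu≢0 ∘ trans (sym (fixed u fu))

  redOrGreen-fixed : ∀ {v} → FrozenWeightsFixed v → RedOrGreen Q v → RedOrGreen (μ j Q) v
  redOrGreen-fixed fixed = map
    (λ (mv , adj , nonpos) → mv , adjacentToFrozen-fixed fixed adj ,
                             λ u fu → subst (_≤ 0ℤ) (sym (fixed u fu)) (nonpos u fu))
    (λ (mv , adj , nonneg) → mv , adjacentToFrozen-fixed fixed adj ,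
                             λ u fu → subst (0ℤ ≤_) (sym (fixed u fu)) (nonneg u fu))

  b-μ-row≢0 : ∀ {u} → b Q j u ≢ 0ℤ → b (μ j Q) j u ≢ 0ℤ
  b-μ-row≢0 {u} ju≢0 = ju≢0 ∘ neg-injective {j = 0ℤ} ∘ trans (sym (b-μ-row u))

  red⇒μ-green : Red Q j → Green (μ j Q) j
  red⇒μ-green (mj , (u , fu , ju≢0) , nonpos) =
    mj , (u , fu , b-μ-row≢0 ju≢0) , λ u fu → subst (0ℤ ≤_) (sym (b-μ-row u)) (neg-mono-≤ (nonpos u fu))

  green⇒μ-red : Green Q j → Red (μ j Q) j
  green⇒μ-red (mj , (u , fu , ju≢0) , nonneg) =
    mj , (u , fu , b-μ-row≢0 ju≢0) , λ u fu → subst (_≤ 0ℤ) (sym (b-μ-row u)) (neg-mono-≤ (nonneg u fu))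

module _ {n : ℕ} (Q : Quiver n) (j : Fin n)
         (skew : SkewSymmetric Q) (complete : Complete Q)
         (mj : Mutable Q j) (cp : CyclePreserving Q j) where
  open ≡-Reasoning

  private
    frozen≢j : ∀ {u} → Frozen Q u → u ≢ j
    frozen≢j fu = ≢-sym (mutable≢frozen Q mj fu)

  fixed-if-v↛j : FrozenPositive Q j → ∀ {v} → v ≢ j → b Q v j ≤ 0ℤ → FrozenWeightsFixed Q j v
  fixed-if-v↛j j⁺ {v} v≢j vj≤0 u fu = begin
    b (μ j Q) v u                          ≡⟨ b-μ-≢-when-u↛j Q j v≢j (frozen≢j fu) (<⇒≤ (skew-pos Q skew (j⁺ u fu))) ⟩
    b Q v u + [ b Q v j ]₊ * [ b Q j u ]₊  ≡⟨ cong (λ x → b Q v u + x * [ b Q j u ]₊) (i≤j⇒i⊔j≡j vj≤0) ⟩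
    b Q v u + 0ℤ                           ≡⟨ +-identityʳ (b Q v u) ⟩
    b Q v u                                ∎

  fixed-if-j↛v : FrozenNegative Q j → ∀ {v} → v ≢ j → b Q j v ≤ 0ℤ → FrozenWeightsFixed Q j v
  fixed-if-j↛v j⁻ {v} v≢j jv≤0 u fu = begin
    b (μ j Q) v u                          ≡⟨ b-μ-≢-when-j↛u Q j v≢j (frozen≢j fu) (<⇒≤ (j⁻ u fu)) ⟩
    b Q v u - [ b Q u j ]₊ * [ b Q j v ]₊  ≡⟨ cong (λ x → b Q v u - [ b Q u j ]₊ * x) (i≤j⇒i⊔j≡j jv≤0) ⟩
    b Q v u - [ b Q u j ]₊ * 0ℤ            ≡⟨ cong (λ x → b Q v u - x) (*-zeroʳ [ b Q u j ]₊) ⟩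
    b Q v u + 0ℤ                           ≡⟨ +-identityʳ (b Q v u) ⟩
    b Q v u                                ∎

  positive-if-v→j : FrozenPositive Q j → ∀ {v} → Mutable Q v → v ≢ j → 0ℤ < b Q v j →
    FrozenPositive (μ j Q) v
  positive-if-v→j j⁺ {v} mv v≢j vj>0 u fu with <-cmp (b Q v u) 0ℤ
  ... | tri≈ _ vu≡0 _ = contradiction vu≡0 (complete⇒mutable-frozen-b≢0 Q complete mv fu)
  ... | tri> _ _ vu>0 = subst (0ℤ <_) (sym b-μ-vu) (+-mono-< vu>0 (pos*pos⇒pos vj>0 (j⁺ u fu)))
    where
    b-μ-vu : b (μ j Q) v u ≡ b Q v u + b Q v j * b Q j u
    b-μ-vu = trans (b-μ-≢-when-u↛j Q j v≢j (frozen≢j fu) (<⇒≤ (skew-pos Q skew (j⁺ u fu))))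
                   (cong₂ (λ x y → b Q v u + x * y) ([]₊-pos vj>0) ([]₊-pos (j⁺ u fu)))
  ... | tri< vu<0 _ _ = proj₂ (cyclePreserving⇒opposite-arrow-reversed Q j cp cycle) vu<0
    where
    cycle : IsOrientedCycle Q u j v
    cycle = frozen≢j fu , ≢-sym v≢j , ≢-sym (mutable≢frozen Q mv fu) , inj₂ (inj₁ (mj , mv)) ,
            inj₂ (skew-pos Q skew (j⁺ u fu) , skew-pos Q skew vj>0 , vu<0)

  negative-if-j→v : FrozenNegative Q j → ∀ {v} → Mutable Q v → v ≢ j → 0ℤ < b Q j v →
    FrozenNegative (μ j Q) v
  negative-if-j→v j⁻ {v} mv v≢j jv>0 u fu with <-cmp (b Q v u) 0ℤ
  ... | tri≈ _ vu≡0 _ = contradiction vu≡0 (complete⇒mutable-frozen-b≢0 Q complete mv fu)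
  ... | tri< vu<0 _ _ =
          subst (_< 0ℤ) (sym b-μ-vu) (+-mono-< vu<0 (neg-mono-< (pos*pos⇒pos uj>0 jv>0)))
    where
    uj>0 : 0ℤ < b Q u j
    uj>0 = skew-neg Q skew (j⁻ u fu)
    b-μ-vu : b (μ j Q) v u ≡ b Q v u - b Q u j * b Q j v
    b-μ-vu = trans (b-μ-≢-when-j↛u Q j v≢j (frozen≢j fu) (<⇒≤ (j⁻ u fu)))
                   (cong₂ (λ x y → b Q v u - x * y) ([]₊-pos uj>0) ([]₊-pos jv>0))
  ... | tri> _ _ vu>0 = proj₁ (cyclePreserving⇒opposite-arrow-reversed Q j cp cycle) vu>0
    where
    cycle : IsOrientedCycle Q u j v
    cycle = frozen≢j fu , ≢-sym v≢j , ≢-sym (mutable≢frozen Q mv fu) , inj₂ (inj₁ (mj , mv)) ,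
            inj₁ (skew-neg Q skew (j⁻ u fu) , jv>0 , vu>0)

  green-dichotomy : FrozenPositive Q j → ∀ {v} → Mutable Q v → v ≢ j →
    FrozenWeightsFixed Q j v ⊎ FrozenPositive (μ j Q) v
  green-dichotomy j⁺ {v} mv v≢j with b Q v j ≤? 0ℤ
  ... | yes vj≤0 = inj₁ (fixed-if-v↛j j⁺ v≢j vj≤0)
  ... | no  vj≰0 = inj₂ (positive-if-v→j j⁺ mv v≢j (≰⇒> vj≰0))

  red-dichotomy : FrozenNegative Q j → ∀ {v} → Mutable Q v → v ≢ j →
    FrozenWeightsFixed Q j v ⊎ FrozenNegative (μ j Q) v
  red-dichotomy j⁻ {v} mv v≢j with b Q j v ≤? 0ℤ
  ... | yes jv≤0 = inj₁ (fixed-if-j↛v j⁻ v≢j jv≤0)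
  ... | no  jv≰0 = inj₂ (negative-if-j→v j⁻ mv v≢j (≰⇒> jv≰0))

  frozenWeightsFixed⊎redOrGreen : RedOrGreen Q j → ∀ {v} → Mutable Q v → v ≢ j →
    FrozenWeightsFixed Q j v ⊎ RedOrGreen (μ j Q) v
  frozenWeightsFixed⊎redOrGreen (inj₁ red@(_ , (u , fu , _) , _)) mv v≢j =
    map₂ (inj₁ ∘ frozenNegative⇒red (μ j Q) mv fu)
         (red-dichotomy (red⇒frozenNegative Q complete red) mv v≢j)
  frozenWeightsFixed⊎redOrGreen (inj₂ green@(_ , (u , fu , _) , _)) mv v≢j =
    map₂ (inj₂ ∘ frozenPositive⇒green (μ j Q) mv fu)
         (green-dichotomy (green⇒frozenPositive Q complete green) mv v≢j)

  redOrGreen-preserved : RedOrGreen Q j → ∀ v → RedOrGreen Q v → RedOrGreen (μ j Q) v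
  redOrGreen-preserved rgj v = preservedAt (v ≟ j)
    where
    preservedAt : Dec (v ≡ j) → RedOrGreen Q v → RedOrGreen (μ j Q) v
    preservedAt (yes refl) = swap ∘ map (red⇒μ-green Q j) (green⇒μ-red Q j)
    preservedAt (no v≢j) rgv = [ (λ fixed → redOrGreen-fixed Q j fixed rgv) , id ]′
                                 (frozenWeightsFixed⊎redOrGreen rgj (redOrGreen⇒mutable Q rgv) v≢j)

lemma3p13 : ∀ {n} (Q : Quiver n) (j : Fin n) →
    SkewSymmetric Q → Complete Q → Mutable Q j → CyclePreserving Q j →
    RedOrGreen Q j →
    (∀ v → RedOrGreen Q v → RedOrGreen (μ j Q) v) ×
    (∀ k → Mutable Q k → ¬ RedOrGreen Q k →
      (∀ u → Frozen Q u → b (μ j Q) k u ≡ b Q k u) ⊎ RedOrGreen (μ j Q) k)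
lemma3p13 Q j skew complete mj cp rgj =
  redOrGreen-preserved Q j skew complete mj cp rgj ,
  λ k mk ¬rgk → frozenWeightsFixed⊎redOrGreen Q j skew complete mj cp rgj mk λ { refl → ¬rgk rgj }
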